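{- Let $A$ be a finite non-empty set of agents and $M=(V,\mathcal{F},\chi,\nu,\{N_a^S\}_{a\in A})$ a simplicial secrecy model. For each $a\in A$ and $v\in V_a$ define $N_a^{S,\mathrm{loc}}(v)=\{U\in N_a^S(v):\mathrm{St}(v)\subseteq U\}$, and let $M^{\mathrm{loc}}=(V,\mathcal{F},\chi,\nu,\{N_a^{S,\mathrm{loc}}\}_{a\in A})$. Then $M^{\mathrm{loc}}$ is a simplicial secrecy model, and for every $\varphi\in\mathcal{L}_{KS}$ and every facet $X$ of $M$, $M,X\Vdash\varphi$ iff $M^{\mathrm{loc}},X\Vdash\varphi$.
   Context: A simplicial complex is a pair $(V,\mathcal{F})$ with $V$ a non-empty set and $\mathcal{F}$ a non-empty family of finite non-empty subsets of $V$ (faces), closed under non-empty subsets. A facet is an inclusion-maximal face; $\mathrm{Fac}$ denotes the set of facets. An $A$-chromatic simplicial complex is $(V,\mathcal{F},\chi)$ with $\chi:V\to A$ injective on every face. An $A$-chromatic simplicial epistemic model is $(V,\mathcal{F},\chi,\nu)$ where $(V,\mathcal{F},\chi)$ is $A$-chromatic, every facet $X$ satisfies $\chi[X]=A$, every vertex lies in some facet, and $\nu:\mathrm{Fac}\to\mathcal{P}(\mathsf{Prop})$ for a countable set $\mathsf{Prop}$. For a facet $X$ and $a\in A$, $v_a(X)$ is the unique vertex of colour $a$ in $X$; $\mathrm{St}(v)=\{X\in\mathrm{Fac}: v\in X\}$; $X\sim_a Y$ iff $v_a(X)=v_a(Y)$. A simplicial secrecy model is $M=(V,\mathcal{F},\chi,\nu,\{N^S_a\}_{a\in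 A})$ where $(V,\mathcal{F},\chi,\nu)$ is such a model and, with $V_a=\{v:\chi(v)=a\}$, each $N_a^S:V_a\to\mathcal{P}(\mathcal{P}(\mathrm{Fac}(M)))$ satisfies (SN): for every $a$, $v\in V_a$, $U\in N_a^S(v)$, every $X\in\mathrm{St}(v)$ and every $b\in A\setminus\{a\}$ there is a facet $Y$ with $X\sim_b Y$ and $Y\notin U$. The language $\mathcal{L}_{KS}$ is $\varphi::=p\mid\neg\varphi\mid(\varphi\wedge\varphi)\mid K_a\varphi\mid S_a\varphi$. Truth at facets: $M,X\Vdash p$ iff $p\in\nu(X)$; Boolean clauses as usual; $M,X\Vdash K_a\varphi$ iff $M,Y\Vdash\varphi$ for all $Y$ with $X\sim_a Y$; $M,X\Vdash S_a\varphi$ iff $M,X\Vdash K_a\varphi$ and $[\![\varphi]\!]\in N_a^S(v_a(X))$, where $[\![\varphi]\!]=\{Y\in\mathrm{Fac}(M):M,Y\Vdash\varphi\}$. -}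

module Defs where

open import Level using (0ℓ)
open import Data.Nat using (ℕ; suc)
open import Data.Fin using (Fin)
open import Data.List using (List; [])
open import Data.List.Membership.Propositional using (_∈_)
import Data.List.Relation.Binary.Subset.Propositional as L
open import Data.Product using (Σ; ∃; _×_; _,_; proj₁; proj₂)
open import Relation.Binary.PropositionalEquality using (_≡_; _≢_)
open import Relation.Nullary using (¬_)
open import Relation.Unary using (Pred)
open import Function.Bundles using (_⇔_)

-- A finite non-empty subset of V is represented
-- by a (non-empty) list of its elements; the face family is closed under
-- non-empty sub-(multi)sets, so being a face depends only on the set of
-- members of the list.

record SimplicialComplex (V : Set) : Set₁ where
  field
    vertex        : V                                  -- V non-empty
    IsFace        : List V → Set
    face-nonempty : ∀ {xs} → IsFace xs → xs ≢ []
    face-exists   : ∃ IsFace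
    face-closed   : ∀ {xs ys} → IsFace xs → ys ≢ [] → ys L.⊆ xs → IsFace ys

  IsFacet : List V → Set
  IsFacet xs = IsFace xs × (∀ ys → IsFace ys → xs L.⊆ ys → ys L.⊆ xs)

-- Agents: A = Fin (suc n) (a finite non-empty set).
-- Propositional variables: a type P (assumed countable in the theorem).

record EpistemicModel (n : ℕ) (P : Set) : Set₁ where
  field
    V         : Set
    complex   : SimplicialComplex V
    χ         : V → Fin (suc n)
  open SimplicialComplex complex public

  Fac : Set
  Fac = Σ (List V) IsFacet

  -- two representatives of the same facet (same set of vertices)
  _≈F_ : Fac → Fac → Set
  X ≈F Y = (proj₁ X L.⊆ proj₁ Y) × (proj₁ Y L.⊆ proj₁ X)

  field
    chromatic : ∀ {xs} → IsFace xs → ∀ {u v} → u ∈ xs → v ∈ xs → χ u ≡ χ v → u ≡ v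
    full      : (X : Fac) (a : Fin (suc n)) → ∃ λ v → v ∈ proj₁ X × χ v ≡ a
    covered   : (v : V) → ∃ λ (X : Fac) → v ∈ proj₁ X
    ν         : Fac → Pred P 0ℓ
    ν-resp    : ∀ {X Y} → X ≈F Y → ∀ {p} → ν X p → ν Y p

  Vₐ : Fin (suc n) → Set
  Vₐ a = Σ V λ v → χ v ≡ a

  vtx : (a : Fin (suc n)) → Fac → Vₐ a
  vtx a X = proj₁ (full X a) , proj₂ (proj₂ (full X a))

  St : V → Pred Fac 0ℓ
  St v X = v ∈ proj₁ X

  _∼[_]_ : Fac → Fin (suc n) → Fac → Set
  X ∼[ a ] Y = proj₁ (vtx a X) ≡ proj₁ (vtx a Y)

  -- a "set of facets" is a predicate on facet representatives that
  -- respects ≈F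
  RespF : Pred Fac 0ℓ → Set
  RespF U = ∀ {X Y} → X ≈F Y → U X → U Y

  Nbhd : Set₁
  Nbhd = (a : Fin (suc n)) → Vₐ a → Pred (Pred Fac 0ℓ) 0ℓ

  -- N is a secrecy neighbourhood assignment:
  --   its members are genuine sets of facets (well defined on facets),
  --   membership is extensional (sets with the same elements are equal),
  --   and condition (SN) holds.
  record IsSecrecyNbhd (N : Nbhd) : Set₁ where
    field
      N-sets : ∀ a (v : Vₐ a) U → N a v U → RespF U
      N-ext  : ∀ a (v : Vₐ a) U U′ → (∀ X → U X ⇔ U′ X) → N a v U → N a v U′
      SN     : ∀ a (v : Vₐ a) U → N a v U →
               ∀ X → St (proj₁ v) X →
               ∀ b → b ≢ a → ∃ λ Y → (X ∼[ b ] Y) × ¬ U Y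

  loc : Nbhd → Nbhd
  loc N a v U = N a v U × (∀ X → St (proj₁ v) X → U X)

record SecrecyModel (n : ℕ) (P : Set) : Set₁ where
  field
    epi       : EpistemicModel n P
  open EpistemicModel epi public
  field
    N         : Nbhd
    isSecrecy : IsSecrecyNbhd N

data Form (n : ℕ) (P : Set) : Set where
  atom : P → Form n P
  ¬′_  : Form n P → Form n P
  _∧′_ : Form n P → Form n P → Form n P
  K    : Fin (suc n) → Form n P → Form n P
  S    : Fin (suc n) → Form n P → Form n P

module _ {n : ℕ} {P : Set} (E : EpistemicModel n P) where
  open EpistemicModel E

  sat : Nbhd → Fac → Form n P → Set
  sat N X (atom p) = ν X p
  sat N X (¬′ φ)   = ¬ sat N X φ
  sat N X (φ ∧′ ψ) = sat N X φ × sat N X ψ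
  sat N X (K a φ)  = ∀ Y → X ∼[ a ] Y → sat N Y φ
  sat N X (S a φ)  = (∀ Y → X ∼[ a ] Y → sat N Y φ) × N a (vtx a X) (λ Y → sat N Y φ)

module Submission where

open import Defs
open import Data.Nat using (ℕ)
open import Data.Product using (_×_; _,_; proj₁; proj₂)
open import Function.Bundles using (_⇔_; mk⇔; Equivalence)
open import Function.Definitions using (Injective)
open import Function.Properties.Equivalence using () renaming (sym to ⇔-sym)
open import Relation.Binary.PropositionalEquality using (_≡_; sym; trans)

-- The facets containing v_a(X) are exactly the facets a-indistinguishable
-- from X, so whenever K_a φ holds at X the set ⟦φ⟧ contains St(v_a(X)).  The
-- only sets on which S_a consults the neighbourhoods are therefore sets on
-- which N and its localisation agree, and truth is preserved by induction on φ.

module _ {n : ℕ} {P : Set} (E : EpistemicModel n P) where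
  open EpistemicModel E
  open Equivalence

  St-vtx⇒∼ : ∀ a X Y → St (proj₁ (vtx a X)) Y → X ∼[ a ] Y
  St-vtx⇒∼ a X Y v∈Y = chromatic (proj₁ (proj₂ Y)) v∈Y (proj₁ (proj₂ (full Y a)))
                         (trans (proj₂ (vtx a X)) (sym (proj₂ (vtx a Y))))

  loc-isSecrecyNbhd : ∀ {N} → IsSecrecyNbhd N → IsSecrecyNbhd (loc N)
  loc-isSecrecyNbhd isSecrecy = record
    { N-sets = λ a v U U∈ → N-sets a v U (proj₁ U∈)
    ; N-ext  = λ a v U U′ U⇔U′ U∈ →
                 N-ext a v U U′ U⇔U′ (proj₁ U∈) , λ X X∈St → to (U⇔U′ X) (proj₂ U∈ X X∈St)
    ; SN     = λ a v U U∈ → SN a v U (proj₁ U∈)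
    }
    where open IsSecrecyNbhd isSecrecy

  NbhdExtensional : Nbhd → Set₁
  NbhdExtensional N = ∀ a v U U′ → (∀ X → U X ⇔ U′ X) → N a v U → N a v U′

  sat⇔sat-loc : ∀ {N} → NbhdExtensional N → ∀ φ X → sat E N X φ ⇔ sat E (loc N) X φ
  sat⇔sat-loc {N} N-ext = go
    where
    go : ∀ φ X → sat E N X φ ⇔ sat E (loc N) X φ
    go (atom p) X = mk⇔ (λ p∈ν → p∈ν) (λ p∈ν → p∈ν)
    go (¬′ φ)   X = mk⇔ (λ ¬φ φ-holds → ¬φ (from (go φ X) φ-holds))
                        (λ ¬φ φ-holds → ¬φ (to (go φ X) φ-holds))
    go (φ ∧′ ψ) X = mk⇔ (λ (φ-holds , ψ-holds) → to (go φ X) φ-holds , to (go ψ X) ψ-holds)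
                        (λ (φ-holds , ψ-holds) → from (go φ X) φ-holds , from (go ψ X) ψ-holds)
    go (K a φ)  X = mk⇔ (λ Kφ Y X∼Y → to (go φ Y) (Kφ Y X∼Y))
                        (λ Kφ Y X∼Y → from (go φ Y) (Kφ Y X∼Y))
    go (S a φ)  X = mk⇔
      (λ (Kφ , ⟦φ⟧∈N) → (λ Y X∼Y → to (go φ Y) (Kφ Y X∼Y))
                      , N-ext a (vtx a X) _ _ (go φ) ⟦φ⟧∈N
                      , λ Y Y∈St → to (go φ Y) (Kφ Y (St-vtx⇒∼ a X Y Y∈St)))
      (λ (Kφ , ⟦φ⟧∈loc) → (λ Y X∼Y → from (go φ Y) (Kφ Y X∼Y))
                        , N-ext a (vtx a X) _ _ (λ Y → ⇔-sym (go φ Y)) (proj₁ ⟦φ⟧∈loc))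

lemma3p12 : {n : ℕ} {P : Set} (ι : P → ℕ) → Injective _≡_ _≡_ ι →
    (M : SecrecyModel n P) →
    EpistemicModel.IsSecrecyNbhd (SecrecyModel.epi M) (EpistemicModel.loc (SecrecyModel.epi M) (SecrecyModel.N M))
    × ((φ : Form n P) (X : EpistemicModel.Fac (SecrecyModel.epi M)) →
    sat (SecrecyModel.epi M) (SecrecyModel.N M) X φ
    ⇔ sat (SecrecyModel.epi M) (EpistemicModel.loc (SecrecyModel.epi M) (SecrecyModel.N M)) X φ)
lemma3p12 _ _ M =
  loc-isSecrecyNbhd epi isSecrecy , sat⇔sat-loc epi (IsSecrecyNbhd.N-ext isSecrecy)
  where open SecrecyModel M
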